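{- Let $\mathrm{M}$ be a matroid of rank $r$ and let $m = h_{F_{i_1}}^{a_1} \dotsb h_{F_{i_k}}^{a_k}$ (with $\emptyset < F_{i_1} < \dotsb < F_{i_k}$, $a_1 \le \operatorname{rk}(F_{i_1})$, $a_j < \operatorname{rk}(F_{i_j}) - \operatorname{rk}(F_{i_{j-1}})$ for $j \ge 2$) be a standard monomial of $A^{\bullet}(\mathrm{M})$. Let $\mathcal{G}_m = \{G_1 < \dotsb < G_k\}$ be a set of essential flats of $m$ (for any choice of maximal chain in its construction). Then $\deg(m \cdot x_{G_1} \dotsb x_{G_k}) = 1$.
   Context: A matroid $\mathrm{M}$ is a finite nonempty atomic ranked lattice $\mathcal{L}_{\mathrm{M}}$ (every element is the join of the atoms below it; every maximal chain in $[\emptyset, F]$ has length $\operatorname{rk}(F)$) whose rank function $\operatorname{rk}$ is submodular; minimal flat $\emptyset$, maximal $E$, $r = \operatorname{rk}(E)$. Let $\overline{\mathcal{L}}_{\mathrm{M}} = \mathcal{L}_{\mathrm{M}} \setminus \{\emptyset\}$. The augmented Chow ring $A^{\bullet}(\mathrm{M})$ is the quotient of $\mathbb{Z}[h_F]_{F \in \overline{\mathcal{L}}_{\mathrm{M}}}$ by $((h_{F} - h_{G \vee F})(h_G - h_{G \vee F}) : F, G) + (h_a^2,\ h_ah_F - h_ah_{F \vee a} : F,\ a \text{ atom})$, graded with $h_F$ in degree $1$. The degree map $\deg \colon A^r(\mathrm{M}) \to \mathbb{Z}$ is the isomorphism with $\deg(h_{F_1}\dotsb h_{F_r}) = 1$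 if $\operatorname{rk}(\bigvee_{i\in T}F_i) \ge |T|$ for all $T \subseteq [r]$ and $0$ otherwise, extended by zero to other degrees. Essential flats: given the standard monomial $m$, extend $F_{i_1} < \dotsb < F_{i_k}$ to a maximal chain $\emptyset = F_0 < F_1 < \dotsb < F_r = E$; $\mathcal{G}_m$ is obtained from this chain by removing, for each $j$, the $a_j$ flats immediately below $F_{i_j}$ (i.e., $F_{i_j - 1}, \dotsc, F_{i_j - a_j}$), and removing $E$. For a proper flat $G$ (i.e., $G \ne E$), with $\mathcal{A}$ the set of atoms not below $G$ and $h_\emptyset = 0$, $x_G = -\sum_{S \subseteq \mathcal{A}} (-1)^{|S|} h_{G \vee \bigvee_{a \in S} a} \in A^1(\mathrm{M})$. -}

module Defs where

open import Level using (0ℓ)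
open import Data.Bool using (Bool; true; false; _∧_; if_then_else_; not)
open import Data.Nat as ℕ using (ℕ; zero; suc; _≤_; _<_; _∸_; _≤ᵇ_; _≡ᵇ_)
open import Data.Nat.Properties using (_<?_; _≤?_)
open import Data.Integer as ℤ using (ℤ; +_; -[1+_])
open import Data.Fin using (Fin)
open import Data.Fin.Properties using (any?; all?) renaming (_≟_ to _≟ᶠ_)
open import Data.List using (List; []; _∷_; _++_; map; foldr; length; filter; allFin; upTo; replicate; concatMap)
open import Data.Product using (_×_; _,_; ∃)
open import Data.Empty renaming (⊥ to Empty)
open import Relation.Nullary using (¬_; Dec; yes; no; does; ¬?)
open import Relation.Nullary.Decidable using (_×-dec_)
open import Relation.Binary using (Rel; Decidable)
open import Relation.Binary.PropositionalEquality using (_≡_; _≢_)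
import Relation.Binary.Lattice.Structures as LS

data SatChain {A : Set} (_⋖_ : Rel A 0ℓ) : A → A → Set where
  [_]  : (x : A) → SatChain _⋖_ x x
  step : ∀ {x y z} → x ⋖ y → SatChain _⋖_ y z → SatChain _⋖_ x z

chainLength : ∀ {A : Set} {_⋖_ : Rel A 0ℓ} {x y : A} → SatChain _⋖_ x y → ℕ
chainLength [ _ ]        = 0
chainLength (step _ ch)  = suc (chainLength ch)

module Order {A : Set} (_≤_ : Rel A 0ℓ) where
  _<ₒ_ : Rel A 0ℓ
  x <ₒ y = (x ≤ y) × (x ≢ y)

  _⋖_ : Rel A 0ℓ
  x ⋖ y = (x <ₒ y) × (∀ z → x <ₒ z → z <ₒ y → Empty)

-- A matroid, following the paper: a finite nonempty atomic ranked
-- lattice with submodular rank function.  The (finite) lattice has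
-- carrier  Fin N.

record Matroid : Set₁ where
  field
    N        : ℕ
    _≼_      : Rel (Fin N) 0ℓ          -- the order of the lattice of flats
    _≼?_     : Decidable _≼_
    _∨_      : Fin N → Fin N → Fin N
    _⊓_      : Fin N → Fin N → Fin N
    top bot  : Fin N
    isBoundedLattice : LS.IsBoundedLattice _≡_ _≼_ _∨_ _⊓_ top bot

  open Order _≼_ public

  Atom : Fin N → Set
  Atom a = bot ⋖ a

  field
    -- atomic: every F is the join (least upper bound) of the atoms below it
    atomic : ∀ F U → (∀ a → Atom a → a ≼ F → a ≼ U) → F ≼ U
    rk     : Fin N → ℕ
    ranked : ∀ F (ch : SatChain _⋖_ bot F) → chainLength ch ≡ rk F
    submodular : ∀ F G → rk (F ∨ G) ℕ.+ rk (F ⊓ G) ≤ rk F ℕ.+ rk G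

  rank : ℕ
  rank = rk top

  _<?ₒ_ : Decidable _<ₒ_
  x <?ₒ y = (x ≼? y) ×-dec ¬? (x ≟ᶠ y)

  _⋖?_ : Decidable _⋖_
  x ⋖? y with x <?ₒ y | any? (λ z → (x <?ₒ z) ×-dec (z <?ₒ y))
  ... | yes p | no q  = yes (p , λ z xz zy → q (z , xz , zy))
  ... | yes p | yes (z , xz , zy) = no (λ { (_ , r) → r z xz zy })
  ... | no p  | _     = no (λ { (q , _) → p q })

sublists : {A : Set} → List A → List (List A)
sublists []       = [] ∷ []
sublists (x ∷ xs) = sublists xs ++ map (x ∷_) (sublists xs)

sumℤ : List ℤ → ℤ
sumℤ = foldr ℤ._+_ (+ 0)

allᵇ : {A : Set} → (A → Bool) → List A → Bool
allᵇ p = foldr (λ x b → p x ∧ b) true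

anyᵇ : {A : Set} → (A → Bool) → List A → Bool
anyᵇ p = foldr (λ x b → if p x then true else b) false

module _ (M : Matroid) where
  open Matroid M

  -- a monomial h_{F₁} ⋯ h_{Fₗ} is represented by the list [F₁,…,Fₗ]
  Monomial : Set
  Monomial = List (Fin N)

  -- a ℤ-linear combination of the generators h_F (F ≠ ∅)
  LinForm : Set
  LinForm = List (ℤ × Fin N)

  degMono : Monomial → ℤ
  degMono m =
    if (length m ≡ᵇ rank) ∧ allᵇ (λ T → length T ≤ᵇ rk (foldr _∨_ bot T)) (sublists m)
    then + 1 else + 0

  -- deg (m · ℓ₁ ⋯ ℓₛ) for a monomial m and linear forms ℓᵢ, by
  -- multilinear expansion (deg is ℤ-linear)
  degProd : Monomial → List LinForm → ℤ
  degProd m []       = degMono m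
  degProd m (ℓ ∷ ls) = sumℤ (map (λ { (c , F) → c ℤ.* degProd (F ∷ m) ls }) ℓ)

  atomsNotBelow : Fin N → List (Fin N)
  atomsNotBelow G = filter (λ a → (bot ⋖? a) ×-dec ¬? (a ≼? G)) (allFin N)

  -- x_G = - Σ_{S ⊆ 𝒜} (-1)^{|S|} h_{G ∨ ⋁S},  with h_∅ = 0
  -- (the coefficient -(-1)^{|S|} is -1 for |S| even, +1 for |S| odd)
  signNeg : ℕ → ℤ
  signNeg zero          = -[1+ 0 ]
  signNeg (suc zero)    = + 1
  signNeg (suc (suc n)) = signNeg n

  xForm : Fin N → LinForm
  xForm G = filter (λ { (_ , F) → ¬? (F ≟ᶠ bot) })
              (map (λ S → signNeg (length S) , foldr _∨_ G S) (sublists (atomsNotBelow G)))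

  degTimesX : Monomial → List (Fin N) → ℤ
  degTimesX m Gs = degProd m (map xForm Gs)

  -- standard monomials  h_{F₀}^{a₀} ⋯ h_{F_{k-1}}^{a_{k-1}}
  -- (indices shifted to start at 0)

  record IsStandardMonomial (k : ℕ) (F : ℕ → Fin N) (a : ℕ → ℕ) : Set where
    field
      bottom<  : 0 < k → bot <ₒ F 0
      chain<   : ∀ j → suc j < k → F j <ₒ F (suc j)
      exp-pos  : ∀ j → j < k → 1 ≤ a j
      exp-first : 0 < k → a 0 ≤ rk (F 0)
      exp-rest : ∀ j → suc j < k → a (suc j) < rk (F (suc j)) ∸ rk (F j)

  monomialList : (k : ℕ) → (ℕ → Fin N) → (ℕ → ℕ) → Monomial
  monomialList k F a = concatMap (λ j → replicate (a j) (F j)) (upTo k)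

  record IsMaximalChain (c : ℕ → Fin N) : Set where
    field
      start : c 0 ≡ bot
      end   : c rank ≡ top
      cover : ∀ i → i < rank → c i ⋖ c (suc i)

  -- essential flats: from c 0 < … < c r remove, for every j < k, the
  -- a j flats immediately below F j = c (p j) (i.e. positions
  -- p j - a j, …, p j - 1), and remove E = c r; listed increasingly
  removed : (k : ℕ) (a p : ℕ → ℕ) → ℕ → Bool
  removed k a p i = anyᵇ (λ j → (p j ∸ a j ≤ᵇ i) ∧ not (p j ≤ᵇ i)) (upTo k)

  essentialFlats : (k : ℕ) (a p : ℕ → ℕ) (c : ℕ → Fin N) → List (Fin N)
  essentialFlats k a p c = map c (Data.List.filterᵇ (λ i → not (removed k a p i)) (upTo rank))

module Submission where

-- Write deg_W for the degree map of the augmented Chow ring of M restricted to [∅, W]: the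
-- monomial h_{F₁} ⋯ h_{Fₗ} has degree 1 iff l = rk W, every Fᵢ ≤ W and #{i | Fᵢ ≤ J} ≤ rk J for
-- every flat J; for W = E this is the given degree map. The key identity is
--   deg_W(m · h_W^a · x_G) = deg_G(m)   whenever G < W and rk W = rk G + a + 1.
-- Expand x_G over the sets S of atoms below W but not below G (the other terms vanish). If
-- deg_G(m) = 1, each S ≠ ∅ contributes -(-1)^|S| and S = ∅ contributes 0, for a total of 1.
-- If deg_G(m) = 0, every S contributes -(-1)^|S| deg_W(m h_W^(a+1)), for a total of 0.
-- Reading the essential flats from the top of the maximal chain down, each one is absorbed by
-- the identity, together with the block h_{F_j}^{a_j} right above it (a = a_j) or alone
-- (a = 0), until what is left is deg_∅(1) = 1 or deg_{F₁}(h_{F₁}^{rk F₁}) = 1.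

open import Defs
open import Data.Nat using (ℕ; _<_; _≤_)
open import Data.Integer using (+_)
open import Data.Fin using (Fin)
open import Data.Product using (_×_)
open import Relation.Binary.PropositionalEquality using (_≡_)

open import Function using (_∘_; _⇔_; mk⇔; Equivalence)
open import Data.Bool as Bool using (Bool; true; false; _∧_; not; T; if_then_else_)
import Data.Bool.Properties as Boolₚ
open import Data.Nat as Nat using (zero; suc; _∸_; z≤n; s≤s; _≤ᵇ_)
import Data.Nat.Properties as ℕₚ
open import Data.Integer as Int using (ℤ)
import Data.Integer.Properties as ℤₚ
open import Algebra.Properties.CommutativeSemigroup ℤₚ.+-commutativeSemigroup using (interchange)
open import Data.Fin.Properties using (any?; all?) renaming (_≟_ to _≟ᶠ_)
open import Data.List using (List; []; _∷_; _++_; map; foldr; length; filter; filterᵇ; replicate; allFin; upTo; concatMap)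
import Data.List.Properties as Listₚ
open import Data.List.Relation.Unary.All as All using (All; []; _∷_)
import Data.List.Relation.Unary.All.Properties as Allₚ
open import Data.List.Relation.Unary.Any using (Any; here; there)
open import Data.List.Membership.Propositional using (_∈_)
open import Data.List.Membership.Propositional.Properties using (∈-allFin; ∈-filter⁺; ∈-filter⁻)
open import Data.List.Relation.Binary.Sublist.Propositional using (_⊆_; []; _∷_; _∷ʳ_; ⊆-refl)
open import Data.List.Relation.Binary.Sublist.Propositional.Properties using (filter-⊆; filter⁺; length-mono-≤; to-≋; All-resp-⊆)
open import Data.List.Relation.Binary.Pointwise using (Pointwise-≡⇒≡)
open import Data.Product using (_,_; proj₁; proj₂; ∃-syntax; Σ-syntax)
open import Data.Sum using (inj₁; inj₂)
open import Relation.Nullary using (¬_; Dec; yes; no; does; _×-dec_; ¬?; contradiction)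
open import Relation.Nullary.Decidable using (dec-true; dec-false; does-⇔; T?)
open import Relation.Unary using (Pred; Decidable; ∁)
open import Relation.Binary.PropositionalEquality using (refl; sym; trans; cong; cong₂; subst; subst₂; module ≡-Reasoning)
import Relation.Binary.Lattice.Structures as LS

module _ where
  open Int using (_+_; _*_)
  open ≡-Reasoning

  sumℤ-++ : ∀ xs ys → sumℤ (xs ++ ys) ≡ sumℤ xs + sumℤ ys
  sumℤ-++ []       ys = sym (ℤₚ.+-identityˡ _)
  sumℤ-++ (x ∷ xs) ys = trans (cong (_+_ x) (sumℤ-++ xs ys)) (sym (ℤₚ.+-assoc x _ _))

  sumℤ-map-+ : ∀ {A : Set} (f g : A → ℤ) xs →
               sumℤ (map (λ x → f x + g x) xs) ≡ sumℤ (map f xs) + sumℤ (map g xs)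
  sumℤ-map-+ f g []       = refl
  sumℤ-map-+ f g (x ∷ xs) =
    trans (cong (_+_ (f x + g x)) (sumℤ-map-+ f g xs)) (interchange (f x) (g x) _ _)

  sumℤ-map-cong : ∀ {A : Set} {f g : A → ℤ} {xs} → All (λ x → f x ≡ g x) xs →
                  sumℤ (map f xs) ≡ sumℤ (map g xs)
  sumℤ-map-cong = cong sumℤ ∘ Listₚ.map-cong-local

  sumℤ-map-zero : ∀ {A : Set} {f : A → ℤ} {xs} → All (λ x → f x ≡ + 0) xs → sumℤ (map f xs) ≡ + 0
  sumℤ-map-zero []         = refl
  sumℤ-map-zero (fx≡0 ∷ ps) = cong₂ _+_ fx≡0 (sumℤ-map-zero ps)

  sum-sublists-∷ : ∀ {A : Set} (h : List A → ℤ) x xs →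
                   sumℤ (map h (sublists (x ∷ xs)))
                     ≡ sumℤ (map h (sublists xs)) + sumℤ (map (h ∘ (x ∷_)) (sublists xs))
  sum-sublists-∷ h x xs = begin
    sumℤ (map h (sublists xs ++ map (x ∷_) (sublists xs)))
      ≡⟨ cong sumℤ (Listₚ.map-++ h (sublists xs) _) ⟩
    sumℤ (map h (sublists xs) ++ map h (map (x ∷_) (sublists xs)))
      ≡⟨ sumℤ-++ (map h (sublists xs)) _ ⟩
    sumℤ (map h (sublists xs)) + sumℤ (map h (map (x ∷_) (sublists xs)))
      ≡⟨ cong (λ ys → sumℤ (map h (sublists xs)) + sumℤ ys) (sym (Listₚ.map-∘ (sublists xs))) ⟩
    sumℤ (map h (sublists xs)) + sumℤ (map (h ∘ (x ∷_)) (sublists xs)) ∎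

  sum-sublists-filter : ∀ {A : Set} {p} {P : Pred A p} (P? : Decidable P) (h : List A → ℤ) →
                        (∀ {S} → Any (∁ P) S → h S ≡ + 0) → ∀ xs →
                        sumℤ (map h (sublists xs)) ≡ sumℤ (map h (sublists (filter P? xs)))
  sum-sublists-filter P? h vanish [] = refl
  sum-sublists-filter P? h vanish (x ∷ xs) with P? x
  ... | yes _ = begin
    sumℤ (map h (sublists (x ∷ xs)))
      ≡⟨ sum-sublists-∷ h x xs ⟩
    sumℤ (map h (sublists xs)) + sumℤ (map (h ∘ (x ∷_)) (sublists xs))
      ≡⟨ cong₂ _+_ (sum-sublists-filter P? h vanish xs)
                   (sum-sublists-filter P? (h ∘ (x ∷_)) (vanish ∘ there) xs) ⟩
    sumℤ (map h (sublists (filter P? xs))) + sumℤ (map (h ∘ (x ∷_)) (sublists (filter P? xs)))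
      ≡⟨ sym (sum-sublists-∷ h x (filter P? xs)) ⟩
    sumℤ (map h (sublists (x ∷ filter P? xs))) ∎
  ... | no ¬px = begin
    sumℤ (map h (sublists (x ∷ xs)))
      ≡⟨ sum-sublists-∷ h x xs ⟩
    sumℤ (map h (sublists xs)) + sumℤ (map (h ∘ (x ∷_)) (sublists xs))
      ≡⟨ cong₂ _+_ (sum-sublists-filter P? h vanish xs)
                   (sumℤ-map-zero (All.tabulate {xs = sublists xs} (λ _ → vanish (here ¬px)))) ⟩
    sumℤ (map h (sublists (filter P? xs))) + + 0
      ≡⟨ ℤₚ.+-identityʳ _ ⟩
    sumℤ (map h (sublists (filter P? xs))) ∎

  δ[] : ∀ {A : Set} → List A → ℤ
  δ[] []      = + 1
  δ[] (_ ∷ _) = + 0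

  sum-δ[] : ∀ {A : Set} (xs : List A) → sumℤ (map δ[] (sublists xs)) ≡ + 1
  sum-δ[] []       = refl
  sum-δ[] (x ∷ xs) = trans (sum-sublists-∷ δ[] x xs)
    (cong₂ _+_ (sum-δ[] xs) (sumℤ-map-zero (All.tabulate {xs = sublists xs} (λ _ → refl))))

  signNeg-+-suc : ∀ M n → signNeg M n + signNeg M (suc n) ≡ + 0
  signNeg-+-suc M zero          = refl
  signNeg-+-suc M (suc zero)    = refl
  signNeg-+-suc M (suc (suc n)) = signNeg-+-suc M n

  -- The sublists of x ∷ xs pair up as S and x ∷ S, whose signs cancel.
  alternating-sum : ∀ {A : Set} M d (x : A) xs →
                    sumℤ (map (λ S → signNeg M (length S) * d) (sublists (x ∷ xs))) ≡ + 0
  alternating-sum M d x xs = begin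
    sumℤ (map (λ S → signNeg M (length S) * d) (sublists (x ∷ xs)))
      ≡⟨ sum-sublists-∷ (λ S → signNeg M (length S) * d) x xs ⟩
    sumℤ (map (λ S → signNeg M (length S) * d) (sublists xs))
      + sumℤ (map (λ S → signNeg M (suc (length S)) * d) (sublists xs))
      ≡⟨ sym (sumℤ-map-+ (λ S → signNeg M (length S) * d) (λ S → signNeg M (suc (length S)) * d) (sublists xs)) ⟩
    sumℤ (map (λ S → signNeg M (length S) * d + signNeg M (suc (length S)) * d) (sublists xs))
      ≡⟨ sumℤ-map-zero (All.tabulate {xs = sublists xs} (λ {S} _ → pair-cancels (length S))) ⟩
    + 0 ∎
    where
    pair-cancels : ∀ n → signNeg M n * d + signNeg M (suc n) * d ≡ + 0
    pair-cancels n = trans (sym (ℤₚ.*-distribʳ-+ d (signNeg M n) _))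
                           (trans (cong (_* d) (signNeg-+-suc M n)) (ℤₚ.*-zeroˡ d))

  indicator : ∀ {A : Set} → Dec A → ℤ
  indicator a? = if does a? then + 1 else + 0

  indicator-yes : ∀ {A : Set} (a? : Dec A) → A → indicator a? ≡ + 1
  indicator-yes a? a = cong (if_then + 1 else + 0) (dec-true a? a)

  indicator-no : ∀ {A : Set} (a? : Dec A) → ¬ A → indicator a? ≡ + 0
  indicator-no a? ¬a = cong (if_then + 1 else + 0) (dec-false a? ¬a)

  indicator-⇔ : ∀ {A B : Set} → A ⇔ B → (a? : Dec A) (b? : Dec B) → indicator a? ≡ indicator b?
  indicator-⇔ A⇔B a? b? = cong (if_then + 1 else + 0) (does-⇔ A⇔B a? b?)

module _ {A : Set} where

  All-sublists⁻ : ∀ {Q : List A → Set} {L T} → All Q (sublists L) → T ⊆ L → Q T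
  All-sublists⁻ {L = []}    (q ∷ []) []       = q
  All-sublists⁻ {L = x ∷ L} qs      (_ ∷ʳ s)   = All-sublists⁻ (Allₚ.++⁻ˡ (sublists L) qs) s
  All-sublists⁻ {L = x ∷ L} qs      (refl ∷ s) = All-sublists⁻ (Allₚ.map⁻ (Allₚ.++⁻ʳ (sublists L) qs)) s

  All-sublists⁺ : ∀ {Q : List A → Set} L → (∀ {T} → T ⊆ L → Q T) → All Q (sublists L)
  All-sublists⁺ []      q = q [] ∷ []
  All-sublists⁺ (x ∷ L) q = Allₚ.++⁺ (All-sublists⁺ L (q ∘ (x ∷ʳ_)))
                                     (Allₚ.map⁺ (All-sublists⁺ L (q ∘ (refl ∷_))))

  T-allᵇ : ∀ (p : A → Bool) xs → T (allᵇ p xs) ⇔ All (T ∘ p) xs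
  T-allᵇ p xs = mk⇔ (to xs) (from xs)
    where
    to : ∀ xs → T (allᵇ p xs) → All (T ∘ p) xs
    to []       _ = []
    to (x ∷ xs) t = let px , rest = Equivalence.to Boolₚ.T-∧ t in px ∷ to xs rest
    from : ∀ xs → All (T ∘ p) xs → T (allᵇ p xs)
    from []       []         = _
    from (x ∷ xs) (px ∷ pxs) = Equivalence.from Boolₚ.T-∧ (px , from xs pxs)

  anyᵇ-∷ʳ : ∀ (f : A → Bool) xs y → anyᵇ f (xs ++ y ∷ []) ≡ anyᵇ f xs Bool.∨ f y
  anyᵇ-∷ʳ f [] y with f y
  ... | true  = refl
  ... | false = refl
  anyᵇ-∷ʳ f (x ∷ xs) y with f x
  ... | true  = refl
  ... | false = anyᵇ-∷ʳ f xs y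

  filterᵇ-cong-local : ∀ {f g : A → Bool} {xs} → All (λ x → f x ≡ g x) xs → filterᵇ f xs ≡ filterᵇ g xs
  filterᵇ-cong-local []                 = refl
  filterᵇ-cong-local {f} {g} {x ∷ _} (fx≡gx ∷ eqs) with f x | g x | fx≡gx
  ... | true  | _ | refl = cong (x ∷_) (filterᵇ-cong-local eqs)
  ... | false | _ | refl = filterᵇ-cong-local eqs

module Flats (M : Matroid) where
  open Matroid M
  open Nat using (_+_)
  open LS.IsBoundedLattice isBoundedLattice public
    using (x≤x∨y; y≤x∨y; ∨-least)
    renaming (refl to ≼-refl; trans to ≼-trans; antisym to ≼-antisym; minimum to bot≼; maximum to ≼top)

  ⋁-base : ∀ G S → G ≼ foldr _∨_ G S
  ⋁-base G []      = ≼-refl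
  ⋁-base G (x ∷ S) = ≼-trans (⋁-base G S) (y≤x∨y x _)

  ⋁-upper : ∀ G S → All (_≼ foldr _∨_ G S) S
  ⋁-upper G []      = []
  ⋁-upper G (x ∷ S) = x≤x∨y x _ ∷ All.map (λ s≼ → ≼-trans s≼ (y≤x∨y x _)) (⋁-upper G S)

  ⋁-least : ∀ {G J} S → G ≼ J → All (_≼ J) S → foldr _∨_ G S ≼ J
  ⋁-least []      G≼J []          = G≼J
  ⋁-least (x ∷ S) G≼J (x≼J ∷ S≼J) = ∨-least x≼J (⋁-least S G≼J S≼J)

  ⋁-notBelow : ∀ {J} G S → Any (λ a → ¬ a ≼ J) S → ¬ foldr _∨_ G S ≼ J
  ⋁-notBelow G S a⋠J ⋁≼J = Allₚ.Any¬⇒¬All a⋠J (All.map (λ s≼ → ≼-trans s≼ ⋁≼J) (⋁-upper G S))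

  atom-between : ∀ {G W} → G <ₒ W → ∃[ a ] ((Atom a × ¬ a ≼ G) × a ≼ W)
  atom-between {G} {W} (G≼W , G≢W) with any? (λ a → ((bot ⋖? a) ×-dec ¬? (a ≼? G)) ×-dec (a ≼? W))
  ... | yes found = found
  ... | no none   = contradiction (≼-antisym G≼W (atomic W G atoms≼G)) G≢W
    where
    atoms≼G : ∀ a → Atom a → a ≼ W → a ≼ G
    atoms≼G a atom a≼W with a ≼? G
    ... | yes a≼G = a≼G
    ... | no a⋠G  = contradiction (a , (atom , a⋠G) , a≼W) none

  _++ᶜ_ : ∀ {x y z} → SatChain _⋖_ x y → SatChain _⋖_ y z → SatChain _⋖_ x z
  [ _ ]       ++ᶜ ch = ch
  step x⋖ ch′ ++ᶜ ch = step x⋖ (ch′ ++ᶜ ch)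

  length-++ᶜ : ∀ {x y z} (ch : SatChain _⋖_ x y) (ch′ : SatChain _⋖_ y z) →
               chainLength (ch ++ᶜ ch′) ≡ chainLength ch + chainLength ch′
  length-++ᶜ [ _ ]       ch′ = refl
  length-++ᶜ (step _ ch) ch′ = cong suc (length-++ᶜ ch ch′)

  #below : Fin N → ℕ
  #below x = length (filter (_≼? x) (allFin N))

  #below-strict : ∀ {x y} → x <ₒ y → #below x < #below y
  #below-strict {x} {y} (x≼y , x≢y) =
    ℕₚ.≤∧≢⇒< (length-mono-≤ below-x⊆below-y) (λ eq → x≢y (≼-antisym x≼y (y≼x eq)))
    where
    below-x⊆below-y : filter (_≼? x) (allFin N) ⊆ filter (_≼? y) (allFin N)
    below-x⊆below-y = filter⁺ (_≼? x) (_≼? y) (λ { refl w≼x → ≼-trans w≼x x≼y }) (⊆-refl {x = allFin N})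
    y≼x : #below x ≡ #below y → y ≼ x
    y≼x eq = proj₂ (∈-filter⁻ (_≼? x) {xs = allFin N} (subst (y ∈_) below-x≡below-y y∈below-y))
      where
      below-x≡below-y = sym (Pointwise-≡⇒≡ (to-≋ eq below-x⊆below-y))
      y∈below-y = ∈-filter⁺ (_≼? y) (∈-allFin y) ≼-refl

  -- The fuel bounds #below y ∸ #below x, which drops whenever the interval is split at z.
  saturatedChain : ∀ {x y} → x ≼ y → SatChain _⋖_ x y
  saturatedChain {x} {y} x≼y = go (suc (#below y ∸ #below x)) x≼y ℕₚ.≤-refl
    where
    go : ∀ n {x y} → x ≼ y → #below y ∸ #below x < n → SatChain _⋖_ x y
    go zero    _ ()
    go (suc n) {x} {y} x≼y fuel with x ≟ᶠ y
    ... | yes refl = [ x ]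
    ... | no x≢y with any? (λ z → (x <?ₒ z) ×-dec (z <?ₒ y))
    ...   | no nothing-between =
            step ((x≼y , x≢y) , λ z x<z z<y → nothing-between (z , x<z , z<y)) [ y ]
    ...   | yes (z , x<z , z<y) =
            go n (proj₁ x<z) (ℕₚ.<-≤-trans (ℕₚ.∸-monoˡ-< (#below-strict z<y) (ℕₚ.<⇒≤ (#below-strict x<z)))
                                           (ℕₚ.≤-pred fuel))
            ++ᶜ go n (proj₁ z<y) (ℕₚ.<-≤-trans (ℕₚ.∸-monoʳ-< (#below-strict x<z) (ℕₚ.<⇒≤ (#below-strict z<y)))
                                               (ℕₚ.≤-pred fuel))

  rankedFrom : ∀ {x F} → x ≡ bot → (ch : SatChain _⋖_ x F) → chainLength ch ≡ rk F
  rankedFrom refl = ranked _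

  rk-bot : rk bot ≡ 0
  rk-bot = sym (ranked bot [ bot ])

  rk-split : ∀ {x y} (x≼y : x ≼ y) → rk y ≡ rk x + chainLength (saturatedChain x≼y)
  rk-split {x} {y} x≼y = begin
    rk y                                       ≡⟨ ranked y (below-x ++ᶜ x-to-y) ⟨
    chainLength (below-x ++ᶜ x-to-y)           ≡⟨ length-++ᶜ below-x x-to-y ⟩
    chainLength below-x + chainLength x-to-y   ≡⟨ cong (_+ chainLength x-to-y) (ranked x below-x) ⟩
    rk x + chainLength x-to-y                  ∎
    where
    open ≡-Reasoning
    below-x = saturatedChain (bot≼ x)
    x-to-y  = saturatedChain x≼y

  rk-mono : ∀ {x y} → x ≼ y → rk x ≤ rk y
  rk-mono {x} x≼y = subst (rk x ≤_) (sym (rk-split x≼y)) (ℕₚ.m≤m+n (rk x) _)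

  rk-strict : ∀ {x y} → x <ₒ y → rk x < rk y
  rk-strict {x} {y} (x≼y , x≢y) =
    subst (rk x <_) (sym (rk-split x≼y)) (ℕₚ.m<m+n (rk x) (nonempty (saturatedChain x≼y)))
    where
    nonempty : (ch : SatChain _⋖_ x y) → 0 < chainLength ch
    nonempty [ _ ]      = contradiction refl x≢y
    nonempty (step _ _) = s≤s z≤n

  rk-injective : ∀ {x y} → x ≼ y → rk x ≡ rk y → x ≡ y
  rk-injective {x} {y} x≼y rk≡ with x ≟ᶠ y
  ... | yes x≡y = x≡y
  ... | no x≢y  = contradiction rk≡ (ℕₚ.<⇒≢ (rk-strict (x≼y , x≢y)))

module OnMaximalChain (M : Matroid) {c : ℕ → Fin (Matroid.N M)} (mc : IsMaximalChain M c) where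
  open Matroid M
  open Flats M
  open IsMaximalChain mc
  open Nat using (_+_)

  rk∘c : ∀ {i} → i ≤ rank → rk (c i) ≡ i
  rk∘c {i} i≤r = let ch , length≡i = chainTo i i≤r in trans (sym (rankedFrom start ch)) length≡i
    where
    chainTo : ∀ i → i ≤ rank → Σ[ ch ∈ SatChain _⋖_ (c 0) (c i) ] chainLength ch ≡ i
    chainTo zero    _   = [ c 0 ] , refl
    chainTo (suc i) i<r with chainTo i (ℕₚ.<⇒≤ i<r)
    ... | ch , length≡i = ch ++ᶜ step (cover i i<r) [ c (suc i) ]
                        , trans (length-++ᶜ ch _) (trans (cong (_+ 1) length≡i) (ℕₚ.+-comm i 1))

  rk∘c-gap : ∀ {g n} d → g + d ≡ n → n ≤ rank → rk (c n) ≡ rk (c g) + d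
  rk∘c-gap {g} d g+d≡n n≤r = trans (rk∘c n≤r) (trans (sym g+d≡n) (cong (_+ d) (sym (rk∘c g≤r))))
    where
    g≤r : g ≤ rank
    g≤r = ℕₚ.m+n≤o⇒m≤o g (subst (_≤ rank) (sym g+d≡n) n≤r)

  c-mono : ∀ {i j} → i ≤ j → j ≤ rank → c i ≼ c j
  c-mono {j = zero}      z≤n  _     = ≼-refl
  c-mono {i} {j = suc j} i≤1+j 1+j≤r with ℕₚ.m≤n⇒m<n∨m≡n i≤1+j
  ... | inj₁ i<1+j = ≼-trans (c-mono (ℕₚ.≤-pred i<1+j) (ℕₚ.<⇒≤ 1+j≤r)) (proj₁ (proj₁ (cover j 1+j≤r)))
  ... | inj₂ refl  = ≼-refl

  c-strict : ∀ {i j} → i < j → j ≤ rank → c i <ₒ c j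
  c-strict i<j j≤r =
    c-mono (ℕₚ.<⇒≤ i<j) j≤r ,
    λ ci≡cj → ℕₚ.<⇒≢ i<j (trans (sym (rk∘c (ℕₚ.≤-trans (ℕₚ.<⇒≤ i<j) j≤r))) (trans (cong rk ci≡cj) (rk∘c j≤r)))

module RelativeDegree (M : Matroid) where
  open Matroid M
  open Flats M
  open Nat using (_+_)

  countBelow : Fin N → List (Fin N) → ℕ
  countBelow J L = length (filter (_≼? J) L)

  Hall : List (Fin N) → Set
  Hall L = ∀ J → countBelow J L ≤ rk J

  HallIn : Fin N → List (Fin N) → Set
  HallIn W L = length L ≡ rk W × Hall L × All (_≼ W) L

  hallIn? : ∀ W L → Dec (HallIn W L)
  hallIn? W L = (length L Nat.≟ rk W) ×-dec all? (λ J → countBelow J L ℕₚ.≤? rk J) ×-dec All.all? (_≼? W) L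

  -- The degree map of the augmented Chow ring of the restriction of M to the interval [∅, W].
  degBelow : Fin N → List (Fin N) → ℤ
  degBelow W L = indicator (hallIn? W L)

  countBelow-accept : ∀ {J x} L → x ≼ J → countBelow J (x ∷ L) ≡ suc (countBelow J L)
  countBelow-accept {J} L x≼J = cong length (Listₚ.filter-accept (_≼? J) {xs = L} x≼J)

  countBelow-reject : ∀ {J x} L → ¬ x ≼ J → countBelow J (x ∷ L) ≡ countBelow J L
  countBelow-reject {J} L x⋠J = cong length (Listₚ.filter-reject (_≼? J) {xs = L} x⋠J)

  countBelow-++ : ∀ J L L′ → countBelow J (L ++ L′) ≡ countBelow J L + countBelow J L′
  countBelow-++ J L L′ = trans (cong length (Listₚ.filter-++ (_≼? J) L L′)) (Listₚ.length-++ (filter (_≼? J) L))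

  countBelow-replicate : ∀ {J W} n → ¬ W ≼ J → countBelow J (replicate n W) ≡ 0
  countBelow-replicate {J} n W⋠J = cong length (Listₚ.filter-none (_≼? J) (Allₚ.replicate⁺ n W⋠J))

  countBelow≤length : ∀ J L → countBelow J L ≤ length L
  countBelow≤length J = Listₚ.length-filter (_≼? J)

  countBelow≤countBelow-∷ : ∀ J x L → countBelow J L ≤ countBelow J (x ∷ L)
  countBelow≤countBelow-∷ J x L with x ≼? J
  ... | yes _ = ℕₚ.n≤1+n _
  ... | no _  = ℕₚ.≤-refl

  countBelow≡length⇒All : ∀ J L → countBelow J L ≡ length L → All (_≼ J) L
  countBelow≡length⇒All J L eq with All.all? (_≼? J) L
  ... | yes L≼J = L≼J
  ... | no ¬L≼J = contradiction eq (ℕₚ.<⇒≢ (Listₚ.filter-notAll (_≼? J) L (Allₚ.¬All⇒Any¬ (_≼? J) L ¬L≼J)))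

  length≤countBelow : ∀ {J S L} → S ⊆ L → All (_≼ J) S → length S ≤ countBelow J L
  length≤countBelow {J} {S} {L} S⊆L S≼J =
    subst (_≤ countBelow J L) (cong length (Listₚ.filter-all (_≼? J) S≼J))
          (length-mono-≤ (filter⁺ (_≼? J) (_≼? J) (λ { refl J≼ → J≼ }) S⊆L))

  sublistRankCondition : List (Fin N) → Bool
  sublistRankCondition L = allᵇ (λ S → length S ≤ᵇ rk (foldr _∨_ bot S)) (sublists L)

  hall⇔sublistRankCondition : ∀ L → Hall L ⇔ T (sublistRankCondition L)
  hall⇔sublistRankCondition L = mk⇔ to from
    where
    to : Hall L → T (sublistRankCondition L)
    to hall = Equivalence.from (T-allᵇ _ (sublists L)) (All-sublists⁺ L λ {S} S⊆L →
      ℕₚ.≤⇒≤ᵇ (ℕₚ.≤-trans (length≤countBelow S⊆L (⋁-upper bot S)) (hall (foldr _∨_ bot S))))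
    from : T (sublistRankCondition L) → Hall L
    from t J = ℕₚ.≤-trans
      (ℕₚ.≤ᵇ⇒≤ _ _ (All-sublists⁻ (Equivalence.to (T-allᵇ _ (sublists L)) t) (filter-⊆ (_≼? J) L)))
      (rk-mono (⋁-least (filter (_≼? J) L) (bot≼ J) (Allₚ.all-filter (_≼? J) L)))

  degMono≡degBelow-top : ∀ L → degMono M L ≡ degBelow top L
  degMono≡degBelow-top L =
    indicator-⇔ (mk⇔ to from) ((length L Nat.≟ rank) ×-dec T? (sublistRankCondition L)) (hallIn? top L)
    where
    to : length L ≡ rank × T (sublistRankCondition L) → HallIn top L
    to (len , t) = len , Equivalence.from (hall⇔sublistRankCondition L) t , All.tabulate (λ {x} _ → ≼top x)
    from : HallIn top L → length L ≡ rank × T (sublistRankCondition L)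
    from (len , hall , _) = len , Equivalence.to (hall⇔sublistRankCondition L) hall

  degBelow-bot∷ : ∀ W L → degBelow W (bot ∷ L) ≡ + 0
  degBelow-bot∷ W L = indicator-no (hallIn? W (bot ∷ L)) λ (_ , hall , _) →
    ℕₚ.n≮0 (subst₂ _≤_ (countBelow-accept L ≼-refl) rk-bot (hall bot))

  degBelow-outside : ∀ {W F} L → ¬ F ≼ W → degBelow W (F ∷ L) ≡ + 0
  degBelow-outside {W} {F} L F⋠W = indicator-no (hallIn? W (F ∷ L)) λ { (_ , _ , F≼W ∷ _) → F⋠W F≼W }

  hall-above : ∀ {W J} L → length L ≡ rk W → W ≼ J → countBelow J L ≤ rk J
  hall-above {W} {J} L len W≼J =
    ℕₚ.≤-trans (countBelow≤length J L) (subst (_≤ rk J) (sym len) (rk-mono W≼J))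

  hallIn-replicate : ∀ W → HallIn W (replicate (rk W) W)
  hallIn-replicate W = Listₚ.length-replicate (rk W) , hall , Allₚ.replicate⁺ (rk W) ≼-refl
    where
    hall : Hall (replicate (rk W) W)
    hall J = by-cases (W ≼? J)
      where
      by-cases : Dec (W ≼ J) → countBelow J (replicate (rk W) W) ≤ rk J
      by-cases (yes W≼J) = hall-above (replicate (rk W) W) (Listₚ.length-replicate (rk W)) W≼J
      by-cases (no W⋠J)  = subst (_≤ rk J) (sym (countBelow-replicate (rk W) W⋠J)) z≤n

  hallIn-raise : ∀ {W F L} → F ≼ W → HallIn W (F ∷ L) → HallIn W (W ∷ L)
  hallIn-raise {W} {F} {L} F≼W (len , hall , _ ∷ L≼W) = len , hall′ , ≼-refl ∷ L≼W
    where
    hall′ : Hall (W ∷ L)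
    hall′ J = by-cases (W ≼? J)
      where
      by-cases : Dec (W ≼ J) → countBelow J (W ∷ L) ≤ rk J
      by-cases (yes W≼J) = hall-above (W ∷ L) len W≼J
      by-cases (no W⋠J)  = subst (_≤ rk J) (sym (countBelow-reject L W⋠J))
                                 (ℕₚ.≤-trans (countBelow≤countBelow-∷ J F L) (hall J))

  tight⇒hallIn : ∀ {G J Y} → length Y ≡ rk G → Hall Y → G ≼ J → countBelow J Y ≡ rk J → HallIn G Y
  tight⇒hallIn {G} {J} {Y} len hall G≼J tight = len , hall , countBelow≡length⇒All G Y countG
    where
    rkG≡rkJ : rk G ≡ rk J
    rkG≡rkJ = ℕₚ.≤-antisym (rk-mono G≼J)
                (subst₂ _≤_ tight len (countBelow≤length J Y))
    countG : countBelow G Y ≡ length Y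
    countG = trans (cong (λ K → countBelow K Y) (rk-injective G≼J rkG≡rkJ))
                   (trans tight (trans (sym rkG≡rkJ) (sym len)))

  module AppendBlock {G W : Fin N} {a : ℕ} (rkW : rk W ≡ rk G + suc a) (Y : List (Fin N)) where

    R : List (Fin N)
    R = Y ++ replicate a W

    countBelow-R : ∀ {J} → ¬ W ≼ J → countBelow J R ≡ countBelow J Y
    countBelow-R {J} W⋠J = trans (countBelow-++ J Y (replicate a W))
      (trans (cong (_+_ (countBelow J Y)) (countBelow-replicate a W⋠J)) (ℕₚ.+-identityʳ _))

    countBelow-Y≤R : ∀ J → countBelow J Y ≤ countBelow J R
    countBelow-Y≤R J = subst (countBelow J Y ≤_) (sym (countBelow-++ J Y (replicate a W))) (ℕₚ.m≤m+n _ _)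

    length-∷R : ∀ F → length (F ∷ R) ≡ length Y + suc a
    length-∷R F = trans (cong suc (trans (Listₚ.length-++ Y) (cong (_+_ (length Y)) (Listₚ.length-replicate a))))
                        (sym (ℕₚ.+-suc (length Y) a))

    length-∷R≡rkW : ∀ F → length Y ≡ rk G → length (F ∷ R) ≡ rk W
    length-∷R≡rkW F len = trans (length-∷R F) (trans (cong (_+ suc a) len) (sym rkW))

    length-Y≡rkG : ∀ F → length (F ∷ R) ≡ rk W → length Y ≡ rk G
    length-Y≡rkG F len = ℕₚ.+-cancelʳ-≡ (suc a) (length Y) (rk G) (trans (sym (length-∷R F)) (trans len rkW))

    hallIn-extend : ∀ {F} → HallIn G Y → G <ₒ F → F ≼ W → HallIn W (F ∷ R)
    hallIn-extend {F} (lenY , hallY , Y≼G) (G≼F , G≢F) F≼W =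
      length-∷R≡rkW F lenY , hall , F≼W ∷ Allₚ.++⁺ (All.map (λ y≼G → ≼-trans y≼G G≼W) Y≼G) (Allₚ.replicate⁺ a ≼-refl)
      where
      G≼W = ≼-trans G≼F F≼W
      hall : Hall (F ∷ R)
      hall J = by-cases (W ≼? J) (F ≼? J)
        where
        by-cases : Dec (W ≼ J) → Dec (F ≼ J) → countBelow J (F ∷ R) ≤ rk J
        by-cases (yes W≼J) _ = hall-above (F ∷ R) (length-∷R≡rkW F lenY) W≼J
        by-cases (no W⋠J) (yes F≼J) = begin
          countBelow J (F ∷ R)   ≡⟨ countBelow-accept R F≼J ⟩
          suc (countBelow J R)   ≡⟨ cong suc (countBelow-R W⋠J) ⟩
          suc (countBelow J Y)   ≤⟨ s≤s (countBelow≤length J Y) ⟩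
          suc (length Y)         ≡⟨ cong suc lenY ⟩
          suc (rk G)             ≤⟨ rk-strict (G≼F , G≢F) ⟩
          rk F                   ≤⟨ rk-mono F≼J ⟩
          rk J                   ∎
          where open ℕₚ.≤-Reasoning
        by-cases (no W⋠J) (no F⋠J) =
          subst (_≤ rk J) (sym (trans (countBelow-reject R F⋠J) (countBelow-R W⋠J))) (hallY J)

    ¬hallIn-base : All (_≼ G) Y → ¬ HallIn W (G ∷ R)
    ¬hallIn-base Y≼G (len , hall , _) = ℕₚ.<-irrefl refl (begin-strict
      rk G                   ≡⟨ length-Y≡rkG G len ⟨
      length Y               ≡⟨ cong length (Listₚ.filter-all (_≼? G) Y≼G) ⟨
      countBelow G Y         ≤⟨ countBelow-Y≤R G ⟩
      countBelow G R         <⟨ ℕₚ.n<1+n _ ⟩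
      suc (countBelow G R)   ≡⟨ countBelow-accept R ≼-refl ⟨
      countBelow G (G ∷ R)   ≤⟨ hall G ⟩
      rk G                   ∎)
      where open ℕₚ.≤-Reasoning

    hallIn-lower : ∀ {F} → ¬ HallIn G Y → G ≼ F → F ≼ W → HallIn W (W ∷ R) → HallIn W (F ∷ R)
    hallIn-lower {F} ¬hallG G≼F F≼W (len , hall , _ ∷ R≼W) = len , hall′ , F≼W ∷ R≼W
      where
      hallY : Hall Y
      hallY J = ℕₚ.≤-trans (countBelow-Y≤R J) (ℕₚ.≤-trans (countBelow≤countBelow-∷ J W R) (hall J))
      hall′ : Hall (F ∷ R)
      hall′ J = by-cases (W ≼? J) (F ≼? J)
        where
        by-cases : Dec (W ≼ J) → Dec (F ≼ J) → countBelow J (F ∷ R) ≤ rk J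
        by-cases (yes W≼J) _ = hall-above (F ∷ R) len W≼J
        by-cases (no W⋠J) (yes F≼J) =
          subst (_≤ rk J) (sym (trans (countBelow-accept R F≼J) (cong suc (countBelow-R W⋠J))))
                (ℕₚ.≤∧≢⇒< (hallY J) (¬hallG ∘ tight⇒hallIn (length-Y≡rkG W len) hallY (≼-trans G≼F F≼J)))
        by-cases (no W⋠J) (no F⋠J) =
          subst (_≤ rk J) (trans (countBelow-reject R W⋠J) (sym (countBelow-reject R F⋠J))) (hall J)

module Expansion (M : Matroid) where
  open Matroid M
  open Int using (_+_; _*_)
  open ≡-Reasoning

  linExt : (Fin N → ℤ) → LinForm M → ℤ
  linExt φ ℓ = sumℤ (map (λ (c , F) → c * φ F) ℓ)

  expand : (Monomial M → ℤ) → Monomial M → List (LinForm M) → ℤ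
  expand d m []       = d m
  expand d m (ℓ ∷ ls) = linExt (λ F → expand d (F ∷ m) ls) ℓ

  linExt-cong : ∀ {φ ψ} ℓ → (∀ F → φ F ≡ ψ F) → linExt φ ℓ ≡ linExt ψ ℓ
  linExt-cong ℓ φ≗ψ = cong sumℤ (Listₚ.map-cong (λ (c , F) → cong (c *_) (φ≗ψ F)) ℓ)

  degProd≡expand : ∀ m ls → degProd M m ls ≡ expand (degMono M) m ls
  degProd≡expand m []       = refl
  degProd≡expand m (ℓ ∷ ls) = linExt-cong ℓ (λ F → degProd≡expand (F ∷ m) ls)

  expand-cong : ∀ {d d′} m ls → (∀ L → d L ≡ d′ L) → expand d m ls ≡ expand d′ m ls
  expand-cong m []       d≗d′ = d≗d′ m
  expand-cong m (ℓ ∷ ls) d≗d′ = linExt-cong ℓ (λ F → expand-cong (F ∷ m) ls d≗d′)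

  expand-∷ʳ : ∀ d m ls ℓ → expand d m (ls ++ ℓ ∷ []) ≡ expand (λ L → linExt (λ F → d (F ∷ L)) ℓ) m ls
  expand-∷ʳ d m []        ℓ = refl
  expand-∷ʳ d m (ℓ′ ∷ ls) ℓ = linExt-cong ℓ′ (λ F → expand-∷ʳ d (F ∷ m) ls ℓ)

  expand-++ : ∀ d m m′ ls → expand d (m ++ m′) ls ≡ expand (λ L → d (L ++ m′)) m ls
  expand-++ d m m′ []       = refl
  expand-++ d m m′ (ℓ ∷ ls) = linExt-cong ℓ (λ F → expand-++ d (F ∷ m) m′ ls)

  linExt-xForm : ∀ {φ} G → φ bot ≡ + 0 →
                 linExt φ (xForm M G)
                   ≡ sumℤ (map (λ S → signNeg M (length S) * φ (foldr _∨_ G S)) (sublists (atomsNotBelow M G)))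
  linExt-xForm {φ} G φ∅≡0 =
    trans (linExt-nonzero (map _ (sublists (atomsNotBelow M G))))
          (cong sumℤ (sym (Listₚ.map-∘ (sublists (atomsNotBelow M G)))))
    where
    linExt-nonzero : ∀ ℓ → linExt φ (filter (λ (_ , F) → ¬? (F ≟ᶠ bot)) ℓ) ≡ linExt φ ℓ
    linExt-nonzero []            = refl
    linExt-nonzero ((c , F) ∷ ℓ) with F ≟ᶠ bot
    ... | no _     = cong (_+_ (c * φ F)) (linExt-nonzero ℓ)
    ... | yes refl = sym (begin
      c * φ bot + linExt φ ℓ   ≡⟨ cong (λ z → c * z + linExt φ ℓ) φ∅≡0 ⟩
      c * + 0 + linExt φ ℓ     ≡⟨ cong (_+ linExt φ ℓ) (ℤₚ.*-zeroʳ c) ⟩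
      + 0 + linExt φ ℓ         ≡⟨ ℤₚ.+-identityˡ _ ⟩
      linExt φ ℓ               ≡⟨ linExt-nonzero ℓ ⟨
      linExt φ (filter (λ (_ , F) → ¬? (F ≟ᶠ bot)) ℓ) ∎)

module KeyIdentity (M : Matroid) where
  open Matroid M
  open Flats M
  open RelativeDegree M
  open Expansion M
  open Int using (_+_; _*_)
  open ≡-Reasoning

  module _ {G W : Fin N} (G<W : G <ₒ W) {a : ℕ} (rkW : rk W ≡ rk G Nat.+ suc a) (Y : List (Fin N)) where
    open AppendBlock rkW Y

    φ : Fin N → ℤ
    φ F = degBelow W (F ∷ R)

    term : List (Fin N) → ℤ
    term S = signNeg M (length S) * φ (foldr _∨_ G S)

    Between : Fin N → Set
    Between x = (Atom x × ¬ x ≼ G) × x ≼ W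

    term-hallIn : HallIn G Y → ∀ S → All Between S → term S ≡ signNeg M (length S) * + 1 + δ[] S
    term-hallIn hallG []      _ =
      -- φ G = 0, and the right-hand side -1 · 1 + 1 computes to 0
      cong (signNeg M 0 *_) (indicator-no (hallIn? W (G ∷ R)) (¬hallIn-base (proj₂ (proj₂ hallG))))
    term-hallIn hallG (x ∷ S) (((_ , x⋠G) , x≼W) ∷ between) =
      trans (cong (signNeg M (length (x ∷ S)) *_) (indicator-yes (hallIn? W (F ∷ R)) (hallIn-extend hallG G<F F≼W)))
            (sym (ℤₚ.+-identityʳ _))
      where
      F = foldr _∨_ G (x ∷ S)
      G<F : G <ₒ F
      G<F = ⋁-base G (x ∷ S) , λ G≡F → x⋠G (subst (x ≼_) (sym G≡F) (x≤x∨y x _))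
      F≼W : F ≼ W
      F≼W = ⋁-least (x ∷ S) (proj₁ G<W) (x≼W ∷ All.map proj₂ between)

    term-¬hallIn : ¬ HallIn G Y → ∀ S → All Between S → term S ≡ signNeg M (length S) * φ W
    term-¬hallIn ¬hallG S between =
      cong (signNeg M (length S) *_)
           (indicator-⇔ (mk⇔ (hallIn-raise F≼W) (hallIn-lower ¬hallG (⋁-base G S) F≼W))
                        (hallIn? W (foldr _∨_ G S ∷ R)) (hallIn? W (W ∷ R)))
      where
      F≼W : foldr _∨_ G S ≼ W
      F≼W = ⋁-least S (proj₁ G<W) (All.map proj₂ between)

    sum-terms : ∀ {x} As → All Between As → x ∈ As → sumℤ (map term (sublists As)) ≡ degBelow G Y
    sum-terms (x ∷ xs) between _ = by-cases (hallIn? G Y)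
      where
      termwise : ∀ {f : List (Fin N) → ℤ} → (∀ S → All Between S → term S ≡ f S) →
                 sumℤ (map term (sublists (x ∷ xs))) ≡ sumℤ (map f (sublists (x ∷ xs)))
      termwise term≡f = sumℤ-map-cong (All-sublists⁺ (x ∷ xs) λ S⊆ → term≡f _ (All-resp-⊆ S⊆ between))
      by-cases : Dec (HallIn G Y) → sumℤ (map term (sublists (x ∷ xs))) ≡ degBelow G Y
      by-cases (yes hallG) = begin
        sumℤ (map term (sublists (x ∷ xs)))
          ≡⟨ termwise (term-hallIn hallG) ⟩
        sumℤ (map (λ S → signNeg M (length S) * + 1 + δ[] S) (sublists (x ∷ xs)))
          ≡⟨ sumℤ-map-+ (λ S → signNeg M (length S) * + 1) δ[] (sublists (x ∷ xs)) ⟩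
        sumℤ (map (λ S → signNeg M (length S) * + 1) (sublists (x ∷ xs))) + sumℤ (map δ[] (sublists (x ∷ xs)))
          ≡⟨ cong₂ _+_ (alternating-sum M (+ 1) x xs) (sum-δ[] (x ∷ xs)) ⟩
        + 1
          ≡⟨ indicator-yes (hallIn? G Y) hallG ⟨
        degBelow G Y ∎
      by-cases (no ¬hallG) = begin
        sumℤ (map term (sublists (x ∷ xs)))
          ≡⟨ termwise (term-¬hallIn ¬hallG) ⟩
        sumℤ (map (λ S → signNeg M (length S) * φ W) (sublists (x ∷ xs)))
          ≡⟨ alternating-sum M (φ W) x xs ⟩
        + 0
          ≡⟨ indicator-no (hallIn? G Y) ¬hallG ⟨
        degBelow G Y ∎

    atomsBetween : List (Fin N)
    atomsBetween = filter (_≼? W) (atomsNotBelow M G)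

    degBelow-times-x : linExt φ (xForm M G) ≡ degBelow G Y
    degBelow-times-x = begin
      linExt φ (xForm M G)
        ≡⟨ linExt-xForm G (degBelow-bot∷ W R) ⟩
      sumℤ (map term (sublists (atomsNotBelow M G)))
        ≡⟨ sum-sublists-filter (_≼? W) term outside-W (atomsNotBelow M G) ⟩
      sumℤ (map term (sublists atomsBetween))
        ≡⟨ sum-terms atomsBetween all-between (∈-filter⁺ (_≼? W) (∈-filter⁺ _ (∈-allFin x) x-notBelow) x≼W) ⟩
      degBelow G Y ∎
      where
      outside-W : ∀ {S} → Any (λ x → ¬ x ≼ W) S → term S ≡ + 0
      outside-W {S} out = trans (cong (signNeg M (length S) *_) (degBelow-outside R (⋁-notBelow G S out)))
                                (ℤₚ.*-zeroʳ (signNeg M (length S)))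
      all-between : All Between atomsBetween
      all-between = All.zip (Allₚ.filter⁺ (_≼? W) (Allₚ.all-filter _ (allFin N)) ,
                             Allₚ.all-filter (_≼? W) (atomsNotBelow M G))
      x = proj₁ (atom-between G<W)
      x-notBelow = proj₁ (proj₂ (atom-between G<W))
      x≼W = proj₂ (proj₂ (atom-between G<W))

  descend : ∀ {G W a} → G <ₒ W → rk W ≡ rk G Nat.+ suc a → ∀ m ls →
            expand (degBelow W) (m ++ replicate a W) (ls ++ xForm M G ∷ []) ≡ expand (degBelow G) m ls
  descend {G} {W} {a} G<W rkW m ls = begin
    expand (degBelow W) (m ++ replicate a W) (ls ++ xForm M G ∷ [])
      ≡⟨ expand-∷ʳ (degBelow W) (m ++ replicate a W) ls (xForm M G) ⟩
    expand (λ L → linExt (λ F → degBelow W (F ∷ L)) (xForm M G)) (m ++ replicate a W) ls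
      ≡⟨ expand-++ _ m (replicate a W) ls ⟩
    expand (λ L → linExt (λ F → degBelow W (F ∷ L ++ replicate a W)) (xForm M G)) m ls
      ≡⟨ expand-cong m ls (degBelow-times-x G<W rkW) ⟩
    expand (degBelow G) m ls ∎

module EssentialChain
  (M : Matroid) {k : ℕ} {F : ℕ → Fin (Matroid.N M)} {a : ℕ → ℕ} (std : IsStandardMonomial M k F a)
  {c : ℕ → Fin (Matroid.N M)} (mc : IsMaximalChain M c)
  {p : ℕ → ℕ} (hp : ∀ j → j < k → (p j ≤ Matroid.rank M) × (c (p j) ≡ F j)) where

  open Matroid M
  open Flats M
  open RelativeDegree M
  open Expansion M
  open KeyIdentity M
  open OnMaximalChain M mc
  open IsStandardMonomial std
  open Nat using (_+_)
  open ≡-Reasoning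

  p≤rank : ∀ {j} → j < k → p j ≤ rank
  p≤rank j<k = proj₁ (hp _ j<k)

  F≡c∘p : ∀ {j} → j < k → F j ≡ c (p j)
  F≡c∘p j<k = sym (proj₂ (hp _ j<k))

  p≡rk∘F : ∀ {j} → j < k → p j ≡ rk (F j)
  p≡rk∘F j<k = trans (sym (rk∘c (p≤rank j<k))) (cong rk (sym (F≡c∘p j<k)))

  p-step : ∀ {j} → suc j < k → p j < p (suc j)
  p-step {j} 1+j<k = subst₂ _<_ (sym (p≡rk∘F (ℕₚ.<-trans (ℕₚ.n<1+n j) 1+j<k))) (sym (p≡rk∘F 1+j<k))
                               (rk-strict (chain< j 1+j<k))

  p-mono : ∀ {i j} → i ≤ j → j < k → p i ≤ p j
  p-mono {j = zero}      z≤n   _     = ℕₚ.≤-refl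
  p-mono {i} {j = suc j} i≤1+j 1+j<k with ℕₚ.m≤n⇒m<n∨m≡n i≤1+j
  ... | inj₁ i<1+j = ℕₚ.≤-trans (p-mono (ℕₚ.≤-pred i<1+j) (ℕₚ.<-trans (ℕₚ.n<1+n j) 1+j<k))
                                (ℕₚ.<⇒≤ (p-step 1+j<k))
  ... | inj₂ refl  = ℕₚ.≤-refl

  pPrev : ℕ → ℕ
  pPrev zero    = 0
  pPrev (suc j) = p j

  pPrev≤p : ∀ {j} → j < k → pPrev j ≤ p j
  pPrev≤p {zero}  _     = z≤n
  pPrev≤p {suc j} 1+j<k = ℕₚ.<⇒≤ (p-step 1+j<k)

  pPrev≤rank : ∀ {j} → j ≤ k → pPrev j ≤ rank
  pPrev≤rank {zero}  _     = z≤n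
  pPrev≤rank {suc j} 1+j≤k = p≤rank 1+j≤k

  p≤pPrev : ∀ {j} → j ≤ k → ∀ j′ → j′ < j → p j′ ≤ pPrev j
  p≤pPrev {suc j} 1+j≤k j′ j′<1+j = p-mono (ℕₚ.≤-pred j′<1+j) 1+j≤k

  exponent-gap : ∀ {j} → suc j < k → a (suc j) < p (suc j) ∸ p j
  exponent-gap {j} 1+j<k =
    subst₂ (λ u v → a (suc j) < u ∸ v) (sym (p≡rk∘F 1+j<k)) (sym (p≡rk∘F (ℕₚ.<-trans (ℕₚ.n<1+n j) 1+j<k)))
           (exp-rest j 1+j<k)

  inBlock : ℕ → ℕ → Bool
  inBlock j i = (p j ∸ a j ≤ᵇ i) ∧ not (p j ≤ᵇ i)

  removed-suc : ∀ kk i → removed M (suc kk) a p i ≡ removed M kk a p i Bool.∨ inBlock kk i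
  removed-suc kk i = trans (cong (anyᵇ (λ j → inBlock j i)) (sym (Listₚ.upTo-∷ʳ kk)))
                           (anyᵇ-∷ʳ (λ j → inBlock j i) (upTo kk) kk)

  inBlock-inside : ∀ {j i} → p j ∸ a j ≤ i → i < p j → inBlock j i ≡ true
  inBlock-inside {j} {i} start≤i i<p =
    cong₂ (λ u v → u ∧ not v) (dec-true (p j ∸ a j ℕₚ.≤? i) start≤i) (dec-false (p j ℕₚ.≤? i) (ℕₚ.<⇒≱ i<p))

  inBlock-above : ∀ {j i} → p j ≤ i → inBlock j i ≡ false
  inBlock-above {j} {i} p≤i =
    trans (cong (λ v → (p j ∸ a j ≤ᵇ i) ∧ not v) (dec-true (p j ℕₚ.≤? i) p≤i)) (Boolₚ.∧-zeroʳ _)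

  inBlock-below : ∀ {j i} → i < p j ∸ a j → inBlock j i ≡ false
  inBlock-below {j} {i} i<start = cong (_∧ not (p j ≤ᵇ i)) (dec-false (p j ∸ a j ℕₚ.≤? i) (ℕₚ.<⇒≱ i<start))

  removed-none : ∀ kk i → (∀ j → j < kk → p j ≤ i) → removed M kk a p i ≡ false
  removed-none zero     i _         = refl
  removed-none (suc kk) i blocks≤i  = trans (removed-suc kk i)
    (cong₂ Bool._∨_ (removed-none kk i (λ j j<kk → blocks≤i j (ℕₚ.m<n⇒m<1+n j<kk)))
                    (inBlock-above (blocks≤i kk ℕₚ.≤-refl)))

  kept : ℕ → ℕ → List ℕ
  kept n kk = filterᵇ (λ i → not (removed M kk a p i)) (upTo n)

  kept-suc : ∀ n kk → kept (suc n) kk ≡ kept n kk ++ filterᵇ (λ i → not (removed M kk a p i)) (n ∷ [])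
  kept-suc n kk = trans (cong (filterᵇ _) (sym (Listₚ.upTo-∷ʳ n))) (Listₚ.filter-++ _ (upTo n) (n ∷ []))

  kept-suc-kept : ∀ {n} kk → removed M kk a p n ≡ false → kept (suc n) kk ≡ kept n kk ++ n ∷ []
  kept-suc-kept {n} kk n-kept rewrite kept-suc n kk | n-kept = refl

  kept-skip : ∀ kk {n n′} → n ≤ n′ → (∀ i → n ≤ i → i < n′ → removed M kk a p i ≡ true) → kept n′ kk ≡ kept n kk
  kept-skip kk {n′ = zero}   z≤n    _       = refl
  kept-skip kk {n} {suc n′} n≤1+n′ removed≡ with ℕₚ.m≤n⇒m<n∨m≡n n≤1+n′
  ... | inj₂ refl  = refl
  ... | inj₁ n<1+n′ rewrite kept-suc n′ kk | removed≡ n′ (ℕₚ.≤-pred n<1+n′) (ℕₚ.n<1+n n′) =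
    trans (Listₚ.++-identityʳ _)
          (kept-skip kk (ℕₚ.≤-pred n<1+n′) (λ i n≤i i<n′ → removed≡ i n≤i (ℕₚ.m<n⇒m<1+n i<n′)))

  kept-block : ∀ {j g} → g + suc (a j) ≡ p j → (∀ j′ → j′ < j → p j′ ≤ g) →
               kept (p j) (suc j) ≡ kept g j ++ g ∷ []
  kept-block {j} {g} g+1+a≡p earlier≤g = begin
    kept (p j) (suc j)        ≡⟨ kept-skip (suc j) 1+g≤p inside ⟩
    kept (suc g) (suc j)      ≡⟨ kept-suc-kept (suc j) (trans (before (ℕₚ.n<1+n g)) (removed-none j g earlier≤g)) ⟩
    kept g (suc j) ++ g ∷ []  ≡⟨ cong (_++ g ∷ []) (filterᵇ-cong-local
                                   (All.map (λ i<g → cong not (before (ℕₚ.m<n⇒m<1+n i<g))) (Allₚ.all-upTo g))) ⟩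
    kept g j ++ g ∷ []        ∎
    where
    start≡1+g : p j ∸ a j ≡ suc g
    start≡1+g = trans (cong (_∸ a j) (trans (sym g+1+a≡p) (ℕₚ.+-suc g (a j)))) (ℕₚ.m+n∸n≡m (suc g) (a j))
    1+g≤p : suc g ≤ p j
    1+g≤p = subst (suc g ≤_) g+1+a≡p (ℕₚ.m<m+n g (s≤s z≤n))
    inside : ∀ i → suc g ≤ i → i < p j → removed M (suc j) a p i ≡ true
    inside i 1+g≤i i<p = trans (removed-suc j i)
      (trans (cong (removed M j a p i Bool.∨_) (inBlock-inside (subst (_≤ i) (sym start≡1+g) 1+g≤i) i<p))
             (Boolₚ.∨-zeroʳ _))
    before : ∀ {i} → i < suc g → removed M (suc j) a p i ≡ removed M j a p i
    before {i} i<1+g = trans (removed-suc j i)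
      (trans (cong (removed M j a p i Bool.∨_) (inBlock-below (subst (i <_) (sym start≡1+g) i<1+g)))
             (Boolₚ.∨-identityʳ _))

  mono : ℕ → List (Fin N)
  mono kk = monomialList M kk F a

  mono-suc : ∀ kk → mono (suc kk) ≡ mono kk ++ replicate (a kk) (F kk)
  mono-suc kk = begin
    concatMap block (upTo (suc kk))          ≡⟨ cong (concatMap block) (Listₚ.upTo-∷ʳ kk) ⟨
    concatMap block (upTo kk ++ kk ∷ [])     ≡⟨ Listₚ.concatMap-++ block (upTo kk) (kk ∷ []) ⟩
    mono kk ++ replicate (a kk) (F kk) ++ [] ≡⟨ cong (mono kk ++_) (Listₚ.++-identityʳ _) ⟩
    mono kk ++ replicate (a kk) (F kk)       ∎
    where
    block = λ j → replicate (a j) (F j)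

  forms : ℕ → ℕ → List (LinForm M)
  forms n kk = map (xForm M) (map c (kept n kk))

  forms-∷ʳ : ∀ {K K′ g} → K′ ≡ K ++ g ∷ [] →
             map (xForm M) (map c K′) ≡ map (xForm M) (map c K) ++ xForm M (c g) ∷ []
  forms-∷ʳ {K} {g = g} refl =
    trans (cong (map (xForm M)) (Listₚ.map-++ c K (g ∷ []))) (Listₚ.map-++ (xForm M) (map c K) _)

  DegreeOne : ℕ → ℕ → Set
  DegreeOne n kk = expand (degBelow (c n)) (mono kk) (forms n kk) ≡ + 1

  degreeOne-start : DegreeOne 0 0
  degreeOne-start = indicator-yes (hallIn? (c 0) []) (sym (rk∘c z≤n) , (λ _ → z≤n) , [])

  plain-step : ∀ {n kk} → (∀ j → j < kk → p j ≤ n) → suc n ≤ rank → DegreeOne n kk → DegreeOne (suc n) kk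
  plain-step {n} {kk} blocks≤n 1+n≤r deg = begin
    expand (degBelow (c (suc n))) (mono kk) (forms (suc n) kk)
      ≡⟨ cong₂ (expand (degBelow (c (suc n)))) (sym (Listₚ.++-identityʳ (mono kk)))
               (forms-∷ʳ (kept-suc-kept kk (removed-none kk n blocks≤n))) ⟩
    expand (degBelow (c (suc n))) (mono kk ++ replicate 0 (c (suc n))) (forms n kk ++ xForm M (c n) ∷ [])
      ≡⟨ descend (c-strict (ℕₚ.n<1+n n) 1+n≤r) (rk∘c-gap 1 (ℕₚ.+-comm n 1) 1+n≤r) (mono kk) (forms n kk) ⟩
    expand (degBelow (c n)) (mono kk) (forms n kk)
      ≡⟨ deg ⟩
    + 1 ∎

  ascend : ∀ {n n′ kk} → (∀ j → j < kk → p j ≤ n) → n ≤ n′ → n′ ≤ rank → DegreeOne n kk → DegreeOne n′ kk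
  ascend {n′ = zero} _ z≤n _ deg = deg
  ascend {n} {suc n′} blocks≤n n≤1+n′ 1+n′≤r deg with ℕₚ.m≤n⇒m<n∨m≡n n≤1+n′
  ... | inj₂ refl   = deg
  ... | inj₁ n<1+n′ =
    plain-step (λ j j<kk → ℕₚ.≤-trans (blocks≤n j j<kk) (ℕₚ.≤-pred n<1+n′)) 1+n′≤r
               (ascend blocks≤n (ℕₚ.≤-pred n<1+n′) (ℕₚ.<⇒≤ 1+n′≤r) deg)

  block-step : ∀ {j g} → j < k → g + suc (a j) ≡ p j → (∀ j′ → j′ < j → p j′ ≤ g) →
               DegreeOne g j → DegreeOne (p j) (suc j)
  block-step {j} {g} j<k g+1+a≡p earlier≤g deg = begin
    expand (degBelow (c (p j))) (mono (suc j)) (forms (p j) (suc j))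
      ≡⟨ cong₂ (expand (degBelow (c (p j))))
               (trans (mono-suc j) (cong (λ W → mono j ++ replicate (a j) W) (F≡c∘p j<k)))
               (forms-∷ʳ (kept-block g+1+a≡p earlier≤g)) ⟩
    expand (degBelow (c (p j))) (mono j ++ replicate (a j) (c (p j))) (forms g j ++ xForm M (c g) ∷ [])
      ≡⟨ descend (c-strict g<p (p≤rank j<k)) (rk∘c-gap (suc (a j)) g+1+a≡p (p≤rank j<k)) (mono j) (forms g j) ⟩
    expand (degBelow (c g)) (mono j) (forms g j)
      ≡⟨ deg ⟩
    + 1 ∎
    where
    g<p : g < p j
    g<p = subst (g <_) g+1+a≡p (ℕₚ.m<m+n g (s≤s z≤n))

  -- The one case with no essential flat below a block: a₀ = rk F₀, so m starts with h_{F₀}^{rk F₀}.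
  full-first-block : 0 < k → a 0 ≡ p 0 → DegreeOne (p 0) 1
  full-first-block 0<k a≡p = begin
    expand (degBelow W) (mono 1) (forms (p 0) 1)
      ≡⟨ cong₂ (λ m K → expand (degBelow W) m (map (xForm M) (map c K))) mono≡ kept≡[] ⟩
    degBelow W (replicate (rk W) W)
      ≡⟨ indicator-yes (hallIn? W (replicate (rk W) W)) (hallIn-replicate W) ⟩
    + 1 ∎
    where
    W = c (p 0)
    mono≡ : mono 1 ≡ replicate (rk W) W
    mono≡ = trans (mono-suc 0) (cong₂ replicate (trans a≡p (sym (rk∘c (p≤rank 0<k)))) (F≡c∘p 0<k))
    start≡0 : p 0 ∸ a 0 ≡ 0
    start≡0 = trans (cong (p 0 ∸_) a≡p) (ℕₚ.n∸n≡0 (p 0))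
    kept≡[] : kept (p 0) 1 ≡ []
    kept≡[] = kept-skip 1 z≤n λ i _ i<p →
      trans (removed-suc 0 i) (inBlock-inside (subst (_≤ i) (sym start≡0) z≤n) i<p)

  through-gap : ∀ {j} → j < k → a j < p j ∸ pPrev j → DegreeOne (pPrev j) j → DegreeOne (p j) (suc j)
  through-gap {j} j<k gap deg =
    block-step j<k g+1+a≡p (λ j′ j′<j → ℕₚ.≤-trans (p≤pPrev (ℕₚ.<⇒≤ j<k) j′ j′<j) prev≤g)
               (ascend (p≤pPrev (ℕₚ.<⇒≤ j<k)) prev≤g g≤rank deg)
    where
    g = p j ∸ suc (a j)
    1+a≤p : suc (a j) ≤ p j
    1+a≤p = ℕₚ.≤-trans gap (ℕₚ.m∸n≤m (p j) (pPrev j))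
    g+1+a≡p : g + suc (a j) ≡ p j
    g+1+a≡p = ℕₚ.m∸n+n≡m 1+a≤p
    prev≤g : pPrev j ≤ g
    prev≤g = ℕₚ.m+n≤o⇒m≤o∸n (pPrev j)
               (subst (pPrev j + suc (a j) ≤_) (ℕₚ.m+[n∸m]≡n (pPrev≤p j<k)) (ℕₚ.+-monoʳ-≤ (pPrev j) gap))
    g≤rank : g ≤ rank
    g≤rank = ℕₚ.≤-trans (ℕₚ.m∸n≤m (p j) (suc (a j))) (p≤rank j<k)

  reach : ∀ j → j ≤ k → DegreeOne (pPrev j) j
  reach zero          _     = degreeOne-start
  reach (suc zero)    1≤k with a 0 Nat.≟ p 0
  ... | yes a≡p = full-first-block 1≤k a≡p
  ... | no  a≢p = through-gap 1≤k (ℕₚ.≤∧≢⇒< (subst (a 0 ≤_) (sym (p≡rk∘F 1≤k)) (exp-first 1≤k)) a≢p)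
                              degreeOne-start
  reach (suc (suc j)) 2+j≤k = through-gap 2+j≤k (exponent-gap 2+j≤k) (reach (suc j) (ℕₚ.<⇒≤ 2+j≤k))

  degreeOne-top : DegreeOne rank k
  degreeOne-top = ascend (p≤pPrev ℕₚ.≤-refl) (pPrev≤rank ℕₚ.≤-refl) ℕₚ.≤-refl (reach k ℕₚ.≤-refl)

proposition2p14 : (M : Matroid) (k : ℕ) (F : ℕ → Fin (Matroid.N M)) (a : ℕ → ℕ)
    → IsStandardMonomial M k F a
    → (c : ℕ → Fin (Matroid.N M)) → IsMaximalChain M c
    → (p : ℕ → ℕ) → (∀ j → j < k → (p j ≤ Matroid.rank M) × (c (p j) ≡ F j))
    → degTimesX M (monomialList M k F a) (essentialFlats M k a p c) ≡ + 1
proposition2p14 M k F a std c mc p hp = begin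
  degProd M (mono k) (forms rank k)
    ≡⟨ degProd≡expand (mono k) (forms rank k) ⟩
  expand (degMono M) (mono k) (forms rank k)
    ≡⟨ expand-cong (mono k) (forms rank k) degMono≡degBelow-top ⟩
  expand (degBelow top) (mono k) (forms rank k)
    ≡⟨ cong (λ W → expand (degBelow W) (mono k) (forms rank k)) end ⟨
  expand (degBelow (c rank)) (mono k) (forms rank k)
    ≡⟨ degreeOne-top ⟩
  + 1 ∎
  where
  open Matroid M using (top; rank)
  open IsMaximalChain mc using (end)
  open RelativeDegree M using (degBelow; degMono≡degBelow-top)
  open Expansion M using (expand; degProd≡expand; expand-cong)
  open EssentialChain M std mc hp using (mono; forms; degreeOne-top)
  open ≡-Reasoning
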